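{- Let $\mathcal{A}=(S,A)$ and $\mathcal{B}=(S,B)$ be inhibitorless reaction systems (in $\mathcal{RS}(\infty,0)$) over the same background set $S$. If $\mathrm{res}_{\mathcal{A}}(R_a)\subseteq\mathrm{res}_{\mathcal{B}}(R_a)$ for every reaction $a=(R_a,I_a,P_a)\in A$, then $\mathrm{res}_{\mathcal{A}}(T)\subseteq\mathrm{res}_{\mathcal{B}}(T)$ for every state $T\subseteq S$.
   Context: A reaction over a finite set $S$ is a triple $a=(R_a,I_a,P_a)$ of subsets of $S$ (reactants, inhibitors, products) with $P_a\neq\varnothing$. A reaction system is a pair $\mathcal{A}=(S,A)$ with $S$ a finite background set and $A$ a set of reactions over $S$. A reaction $a$ is enabled in a state $T\subseteq S$ if $R_a\subseteq T$ and $I_a\cap T=\varnothing$. The result function is $\mathrm{res}_{\mathcal{A}}(T)=\bigcup\{P_a : a\in A \text{ enabled in } T\}$. $\mathcal{RS}(\infty,0)$ (inhibitorless systems) is the class of reaction systems in which every reaction has $I_a=\varnothing$. -}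

module Defs where

open import Data.Nat using (ℕ)
open import Data.Fin using (Fin)
open import Data.Fin.Subset using (Subset; _⊆_; _∈_; _∩_; ⊥; Nonempty)
open import Data.List using (List)
import Data.List.Membership.Propositional as L
open import Data.Product using (Σ; ∃; _×_)
open import Relation.Binary.PropositionalEquality using (_≡_)

record Reaction (n : ℕ) : Set where
  field
    R : Subset n
    I : Subset n
    P : Subset n
    P-nonempty : Nonempty P
open Reaction public

record ReactionSystem (n : ℕ) : Set where
  field
    reactions : List (Reaction n)
open ReactionSystem public

Inhibitorless : ∀ {n} → ReactionSystem n → Set
Inhibitorless 𝒜 = ∀ a → a L.∈ reactions 𝒜 → I a ≡ ⊥

Enabled : ∀ {n} → Reaction n → Subset n → Set
Enabled a T = (R a ⊆ T) × (I a ∩ T ≡ ⊥)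

-- Membership in res_𝒜(T) = ⋃ { P_a : a ∈ A enabled in T }.
_∈res[_]_ : ∀ {n} → Fin n → ReactionSystem n → Subset n → Set
x ∈res[ 𝒜 ] T = Σ (Reaction _) λ a → (a L.∈ reactions 𝒜) × Enabled a T × (x ∈ P a)

ResSub : ∀ {n} → ReactionSystem n → ReactionSystem n → Subset n → Set
ResSub 𝒜 ℬ T = ∀ x → x ∈res[ 𝒜 ] T → x ∈res[ ℬ ] T

{-# OPTIONS --safe #-}
module Submission where

-- A reaction with no inhibitors is enabled in every state containing its reactants,
-- so res of an inhibitorless system is monotone. If x ∈ res_𝒜(T) via a, then a is
-- enabled in R_a ⊆ T, so by hypothesis x ∈ res_ℬ(R_a), and monotonicity of res_ℬ
-- lifts this to x ∈ res_ℬ(T).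

open import Defs
open import Data.Nat using (ℕ)
open import Data.Fin using (Fin)
open import Data.Fin.Subset using (Subset; ⊥; _⊆_)
open import Data.Fin.Subset.Properties using (∩-zeroˡ; ⊆-refl; ⊆-trans)
open import Data.Product using (_,_)
open import Relation.Binary.PropositionalEquality using (_≡_)
import Data.List.Membership.Propositional as L

enabled-if-uninhibited : ∀ {n} (a : Reaction n) {T : Subset n} →
  I a ≡ ⊥ → R a ⊆ T → Enabled a T
enabled-if-uninhibited a {T} I≡⊥ R⊆T rewrite I≡⊥ = R⊆T , ∩-zeroˡ T

∈res-mono : ∀ {n} {ℬ : ReactionSystem n} {T U : Subset n} {x : Fin n} →
  Inhibitorless ℬ → T ⊆ U → x ∈res[ ℬ ] T → x ∈res[ ℬ ] U
∈res-mono inh T⊆U (b , b∈ , (R⊆T , _) , x∈P) =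
  b , b∈ , enabled-if-uninhibited b (inh b b∈) (⊆-trans R⊆T T⊆U) , x∈P

proposition1 : (n : ℕ) (𝒜 ℬ : ReactionSystem n) → Inhibitorless 𝒜 → Inhibitorless ℬ →
    (∀ a → a L.∈ reactions 𝒜 → ResSub 𝒜 ℬ (R a)) →
    ∀ (T : Subset n) → ResSub 𝒜 ℬ T
proposition1 n 𝒜 ℬ inh𝒜 inhℬ res⊆ T x (a , a∈ , (R⊆T , _) , x∈P) =
  ∈res-mono inhℬ R⊆T (res⊆ a a∈ x x∈resRa)
  where
  x∈resRa : x ∈res[ 𝒜 ] R a
  x∈resRa = a , a∈ , enabled-if-uninhibited a (inh𝒜 a a∈) ⊆-refl , x∈P
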